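{- Let $\bar a=a_1,\dots,a_n$ and $b$ be elements of a Steiner quasigroup such that $\bar a,b$ is independent, and let $c\in\langle\bar a b\rangle\smallsetminus\langle\bar a\rangle$. The following are equivalent: (1) $b\in\langle\bar a,c\rangle$; (2) $c=t(\bar a,b)$ for some reduced term $t(\bar x,y)$ with exactly one occurrence of $y$; (3) the homomorphism $f:\langle\bar a,b\rangle\to\langle\bar a,b\rangle$ defined by $f(\bar a)=\bar a$ and $f(b)=c$ is surjective; (4) the homomorphism $f:\langle\bar a,b\rangle\to\langle\bar a,b\rangle$ defined by $f(\bar a)=\bar a$ and $f(b)=c$ is an automorphism of $\langle\bar a,b\rangle$.
   Context: A Steiner quasigroup is a set with a binary operation $\cdot$ satisfying $x\cdot y=y\cdot x$, $x\cdot x=x$, $x\cdot(x\cdot y)=y$. A tuple is independent if its entries are pairwise distinct and the substructure they generate is freely generated by them (so maps on the entries extend uniquely to homomorphisms). Terms are built from variables by the binary product. $t_1\sim t_2$ means $t_2$ is obtained from $t_1$ by zero or more applications of commutativity to subterms. A term is reduced if it has no subterm of the form $t_1t_2$ with $t_1\sim t_2$, nor $t_1(t_2t_3)$ with $t_1\sim t_2$ or $t_1\sim t_3$, nor $(t_1t_2)t_3$ with $t_1\sim t_3$ or $t_2\sim t_3$. -}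

module Defs where

open import Data.Nat using (ℕ; zero; suc; _+_)
open import Data.Fin using (Fin; zero; suc; _≟_)
open import Data.Product using (Σ; ∃; _×_; _,_; proj₁; proj₂)
open import Relation.Nullary using (¬_; yes; no)
open import Relation.Binary.PropositionalEquality using (_≡_; refl; cong₂)
open import Relation.Binary.Construct.Closure.ReflexiveTransitive using (Star)
open import Function.Definitions using (Injective)

record SteinerQuasigroup : Set₁ where
  infixl 7 _·_
  field
    Carrier : Set
    _·_     : Carrier → Carrier → Carrier
    comm    : ∀ x y → x · y ≡ y · x
    idem    : ∀ x → x · x ≡ x
    cancel  : ∀ x y → x · (x · y) ≡ y

infixl 7 _∙_
data Term (V : Set) : Set where
  var : V → Term V
  _∙_ : Term V → Term V → Term V

data CommStep {V : Set} : Term V → Term V → Set where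
  here  : ∀ t₁ t₂ → CommStep (t₁ ∙ t₂) (t₂ ∙ t₁)
  left  : ∀ {t₁ t₁′} t₂ → CommStep t₁ t₁′ → CommStep (t₁ ∙ t₂) (t₁′ ∙ t₂)
  right : ∀ t₁ {t₂ t₂′} → CommStep t₂ t₂′ → CommStep (t₁ ∙ t₂) (t₁ ∙ t₂′)

infix 4 _∼_
_∼_ : {V : Set} → Term V → Term V → Set
_∼_ = Star CommStep

infix 4 _⊑_
data _⊑_ {V : Set} : Term V → Term V → Set where
  self  : ∀ {t} → t ⊑ t
  inl   : ∀ {s t₁ t₂} → s ⊑ t₁ → s ⊑ t₁ ∙ t₂
  inr   : ∀ {s t₁ t₂} → s ⊑ t₂ → s ⊑ t₁ ∙ t₂

data Forbidden {V : Set} : Term V → Set where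
  f-idem : ∀ {t₁ t₂} → t₁ ∼ t₂ → Forbidden (t₁ ∙ t₂)
  f-r₁   : ∀ {t₁ t₂ t₃} → t₁ ∼ t₂ → Forbidden (t₁ ∙ (t₂ ∙ t₃))
  f-r₂   : ∀ {t₁ t₂ t₃} → t₁ ∼ t₃ → Forbidden (t₁ ∙ (t₂ ∙ t₃))
  f-l₁   : ∀ {t₁ t₂ t₃} → t₁ ∼ t₃ → Forbidden ((t₁ ∙ t₂) ∙ t₃)
  f-l₂   : ∀ {t₁ t₂ t₃} → t₂ ∼ t₃ → Forbidden ((t₁ ∙ t₂) ∙ t₃)

Reduced : {V : Set} → Term V → Set
Reduced t = ∀ s → s ⊑ t → ¬ Forbidden s

occ₀ : ∀ {n} → Term (Fin (suc n)) → ℕ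
occ₀ (var zero)    = 1
occ₀ (var (suc _)) = 0
occ₀ (t ∙ s)       = occ₀ t + occ₀ s

-- the tuple  ā, b  (b is the variable  zero , a_i is the variable  suc i)
_▷_ : ∀ {A : Set} {n} → (Fin n → A) → A → Fin (suc n) → A
(ā ▷ b) zero    = b
(ā ▷ b) (suc i) = ā i

module _ (Q : SteinerQuasigroup) where
  open SteinerQuasigroup Q

  eval : ∀ {V : Set} → (V → Carrier) → Term V → Carrier
  eval g (var v) = g v
  eval g (t ∙ s) = eval g t · eval g s

  _∈⟨_⟩ : ∀ {m} → Carrier → (Fin m → Carrier) → Set
  x ∈⟨ g ⟩ = ∃ λ t → eval g t ≡ x

  Sub : ∀ {m} → (Fin m → Carrier) → Set
  Sub g = Σ Carrier (λ x → x ∈⟨ g ⟩)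

  _·ₛ_ : ∀ {m} {g : Fin m → Carrier} → Sub g → Sub g → Sub g
  (x , t , p) ·ₛ (y , s , q) = x · y , t ∙ s , cong₂ _·_ p q

  gen : ∀ {m} (g : Fin m → Carrier) (i : Fin m) → Sub g
  gen g i = g i , var i , refl

  -- homomorphisms ⟨ g ⟩ → B (functions on the subtype respecting
  -- the underlying equality and preserving the product)
  IsHomTo : ∀ {m} {g : Fin m → Carrier} (B : SteinerQuasigroup) →
            (Sub g → SteinerQuasigroup.Carrier B) → Set
  IsHomTo {g = g} B h =
    (∀ (x y : Sub g) → proj₁ x ≡ proj₁ y → h x ≡ h y) ×
    (∀ (x y : Sub g) → h (x ·ₛ y) ≡ SteinerQuasigroup._·_ B (h x) (h y))

  -- independence: pairwise distinct entries, and ⟨ g ⟩ freely generated by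
  -- them: every map on the entries into any Steiner quasigroup extends
  -- uniquely to a homomorphism
  Independent : ∀ {m} → (Fin m → Carrier) → Set₁
  Independent {m} g =
    Injective _≡_ _≡_ g ×
    (∀ (B : SteinerQuasigroup) (φ : Fin m → SteinerQuasigroup.Carrier B) →
      Σ (Sub g → SteinerQuasigroup.Carrier B) λ h →
        IsHomTo B h × (∀ i → h (gen g i) ≡ φ i) ×
        (∀ h′ → IsHomTo B h′ → (∀ i → h′ (gen g i) ≡ φ i) →
           ∀ x → h′ x ≡ h x))

  IsEndo : ∀ {m} {g : Fin m → Carrier} → (Sub g → Sub g) → Set
  IsEndo {g = g} f =
    (∀ (x y : Sub g) → proj₁ x ≡ proj₁ y → proj₁ (f x) ≡ proj₁ (f y)) ×
    (∀ (x y : Sub g) → proj₁ (f (x ·ₛ y)) ≡ proj₁ (f x) · proj₁ (f y))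

  SurjectiveSub : ∀ {m} {g : Fin m → Carrier} → (Sub g → Sub g) → Set
  SurjectiveSub {g = g} f = ∀ (y : Sub g) → ∃ λ x → proj₁ (f x) ≡ proj₁ y

  InjectiveSub : ∀ {m} {g : Fin m → Carrier} → (Sub g → Sub g) → Set
  InjectiveSub {g = g} f =
    ∀ (x y : Sub g) → proj₁ (f x) ≡ proj₁ (f y) → proj₁ x ≡ proj₁ y

  IsAutomorphism : ∀ {m} {g : Fin m → Carrier} → (Sub g → Sub g) → Set
  IsAutomorphism f = IsEndo f × InjectiveSub f × SurjectiveSub f

{-# OPTIONS --safe #-}
-- Write f for the endomorphism fixing ā with f(b) = c.  Its image is ⟨ā, c⟩, so f is onto iff
-- b ∈ ⟨ā, c⟩.  If c = t(ā, b) with y occurring once in t, the factors of t around y can be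
-- peeled off one at a time, giving b = t⁻¹(ā, c); the endomorphism b ↦ t⁻¹(ā, b) is then a
-- left inverse of f, so f is also injective.
--
-- For (1) ⇒ (2) we compute in the free Steiner quasigroup on x₀ (for y) and x̄ (for ā),
-- realised on normal forms: reduced terms with lexicographically sorted products, multiplied by
-- x·x = x, x·(x·w) = w and otherwise by the sorted formal product.  By independence c = T(ā, b)
-- for the normal form T of c, which is a reduced term; T contains x₀ as c ∉ ⟨ā⟩, and mapping
-- b ∈ ⟨ā, c⟩ into the free quasigroup gives x₀ ∈ ⟨x̄, T⟩.  This is impossible if x₀ occurs twice
-- in T: a factor of T without x₀ lies in ⟨x̄⟩ and can be peeled off, and once both factors of T
-- contain x₀, substituting T for x₀ sends normal forms to normal forms (no cancellation can
-- occur) and multiplies the number of occurrences of x₀ by that of T.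
module Submission where

open import Defs
open import Level using (0ℓ)
open import Data.Nat using (ℕ; zero; suc; _+_; _*_; _≤_; _<_; s≤s; z≤n; _≟_; >-nonZero)
open import Data.Nat.Properties
  using (<-irrefl; <-asym; m≤m+n; m≤n+m; m<m+n; m<n+m; +-comm; +-mono-≤;
         *-identityˡ; *-distribʳ-+; m+n≡0⇒m≡0; m+n≡0⇒n≡0; suc-injective; n≢0⇒n>0)
open import Data.Nat.Divisibility using (_∣_; divides; >⇒∤)
open import Data.Fin as F using (Fin)
import Data.Fin.Properties as Fin
open import Data.Product using (∃; _×_; _,_; proj₁; proj₂)
open import Data.Sum using (_⊎_; inj₁; inj₂)
open import Data.Empty using (⊥-elim)
open import Data.Unit using (⊤; tt)
open import Function using (_∘_)
open import Function.Bundles using (_⇔_; mk⇔)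
open import Relation.Nullary using (¬_; Dec; yes; no)
open import Relation.Nullary.Decidable.Core using (recompute; ¬?; _×-dec_)
open import Relation.Binary using (Rel; Trichotomous; tri<; tri≈; tri>; DecidableEquality)
open import Relation.Binary.Consequences using (tri⇒dec≈; tri⇒dec<; tri⇒irr; tri⇒asym)
open import Relation.Binary.PropositionalEquality
  using (_≡_; _≢_; refl; sym; trans; cong; cong₂; subst; ≢-sym; module ≡-Reasoning)
open import Relation.Binary.Construct.Closure.ReflexiveTransitive using (ε; _◅_)

module _ {V : Set} where

  var-injective : ∀ {i j : V} → var i ≡ var j → i ≡ j
  var-injective refl = refl

  ∙-injective : ∀ {t u t′ u′ : Term V} → t ∙ u ≡ t′ ∙ u′ → t ≡ t′ × u ≡ u′
  ∙-injective refl = refl , refl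

  size : Term V → ℕ
  size (var _) = zero
  size (t ∙ u) = suc (size t + size u)

  data IsProduct (t u : Term V) : Term V → Set where
    ordered : IsProduct t u (t ∙ u)
    swapped : IsProduct t u (u ∙ t)

  IsProduct-comm : ∀ {t u p} → IsProduct t u p → IsProduct u t p
  IsProduct-comm ordered = swapped
  IsProduct-comm swapped = ordered

  IsProduct-injective : ∀ {t u t′ u′ p} → IsProduct t u p → IsProduct t′ u′ p →
                        (t ≡ t′ × u ≡ u′) ⊎ (t ≡ u′ × u ≡ t′)
  IsProduct-injective ordered ordered = inj₁ (refl , refl)
  IsProduct-injective ordered swapped = inj₂ (refl , refl)
  IsProduct-injective swapped ordered = inj₂ (refl , refl)
  IsProduct-injective swapped swapped = inj₁ (refl , refl)

  IsProduct-functional : ∀ {t u u′ p} → IsProduct t u p → IsProduct t u′ p → u ≡ u′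
  IsProduct-functional p q with IsProduct-injective p q
  ... | inj₁ (_ , u≡u′)    = u≡u′
  ... | inj₂ (t≡u′ , u≡t) = trans u≡t t≡u′

  infix 4 _∣ᵗ_
  _∣ᵗ_ : Term V → Term V → Set
  t ∣ᵗ p = ∃ λ u → IsProduct t u p

  ∣ᵗ-size : ∀ {t p} → t ∣ᵗ p → size t < size p
  ∣ᵗ-size (_ , ordered) = s≤s (m≤m+n _ _)
  ∣ᵗ-size (_ , swapped) = s≤s (m≤n+m _ _)

  ∣ᵗ-irrefl : ∀ {t} → ¬ t ∣ᵗ t
  ∣ᵗ-irrefl t∣t = <-irrefl refl (∣ᵗ-size t∣t)

  ∣ᵗ-asym : ∀ {t u} → t ∣ᵗ u → ¬ u ∣ᵗ t
  ∣ᵗ-asym t∣u u∣t = <-asym (∣ᵗ-size t∣u) (∣ᵗ-size u∣t)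

  ∣ᵗ-IsProduct : ∀ {t a b p} → t ∣ᵗ p → IsProduct a b p → t ≡ a ⊎ t ≡ b
  ∣ᵗ-IsProduct (_ , q) p with IsProduct-injective q p
  ... | inj₁ (t≡a , _) = inj₁ t≡a
  ... | inj₂ (t≡b , _) = inj₂ t≡b

_[_] : ∀ {V W : Set} → Term V → (V → Term W) → Term W
var v [ σ ]   = σ v
(t ∙ u) [ σ ] = t [ σ ] ∙ u [ σ ]

module _ {n : ℕ} where

  infix 9 _[_]₀
  _[_]₀ : Term (Fin (suc n)) → Term (Fin (suc n)) → Term (Fin (suc n))
  s [ u ]₀ = s [ (var ∘ F.suc) ▷ u ]

  strengthen : (t : Term (Fin (suc n))) → occ₀ t ≡ 0 → Term (Fin n)
  strengthen (var (F.suc i)) _ = var i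
  strengthen (t ∙ u) e =
    strengthen t (m+n≡0⇒m≡0 (occ₀ t) e) ∙ strengthen u (m+n≡0⇒n≡0 (occ₀ t) e)

  occ₀-IsProduct : ∀ {t u p : Term (Fin (suc n))} → IsProduct t u p →
                   occ₀ p ≡ occ₀ t + occ₀ u
  occ₀-IsProduct         ordered = refl
  occ₀-IsProduct {t} {u} swapped = +-comm (occ₀ u) (occ₀ t)

  data Once₀ : Term (Fin (suc n)) → Set where
    here : Once₀ (var F.zero)
    _∙ˡ_ : ∀ {t u} → Once₀ t → occ₀ u ≡ 0 → Once₀ (t ∙ u)
    _∙ʳ_ : ∀ {t u} → occ₀ t ≡ 0 → Once₀ u → Once₀ (t ∙ u)

  once₀ : ∀ t → occ₀ t ≡ 1 → Once₀ t
  once₀ (var F.zero) _ = here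
  once₀ (t ∙ u) e with occ₀ t in eₜ
  ... | zero     = eₜ ∙ʳ once₀ u e
  ... | suc zero = once₀ t eₜ ∙ˡ suc-injective e
  once₀ (t ∙ u) () | suc (suc _)

  -- z = t(y)·u with u free of y gives t(y) = u·z, and so on down to y.
  invert : ∀ {t} → Once₀ t → Term (Fin (suc n))
  invert here               = var F.zero
  invert (_∙ˡ_ {u = u} p _) = invert p [ u ∙ var F.zero ]₀
  invert (_∙ʳ_ {t = t} _ p) = invert p [ t ∙ var F.zero ]₀

module _ (Q : SteinerQuasigroup) where
  open SteinerQuasigroup Q

  eval-cong : ∀ {V : Set} {ρ ρ′ : V → Carrier} → (∀ v → ρ v ≡ ρ′ v) →
              ∀ t → eval Q ρ t ≡ eval Q ρ′ t
  eval-cong ρ≗ρ′ (var v) = ρ≗ρ′ v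
  eval-cong ρ≗ρ′ (t ∙ u) = cong₂ _·_ (eval-cong ρ≗ρ′ t) (eval-cong ρ≗ρ′ u)

  eval-[] : ∀ {V W : Set} (ρ : W → Carrier) (σ : V → Term W) t →
            eval Q ρ (t [ σ ]) ≡ eval Q (eval Q ρ ∘ σ) t
  eval-[] ρ σ (var v) = refl
  eval-[] ρ σ (t ∙ u) = cong₂ _·_ (eval-[] ρ σ t) (eval-[] ρ σ u)

  eval-[]₀ : ∀ {n} (ρ : Fin (suc n) → Carrier) u s →
             eval Q ρ (s [ u ]₀) ≡ eval Q ((ρ ∘ F.suc) ▷ eval Q ρ u) s
  eval-[]₀ ρ u s = trans (eval-[] ρ _ s) (eval-cong pointwise s)
    where
    pointwise : ∀ i → eval Q ρ (((var ∘ F.suc) ▷ u) i) ≡ ((ρ ∘ F.suc) ▷ eval Q ρ u) i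
    pointwise F.zero    = refl
    pointwise (F.suc i) = refl

  ∈⟨▷⟩-trans : ∀ {n} {ā : Fin n → Carrier} {x y z} →
               _∈⟨_⟩ Q x (ā ▷ y) → _∈⟨_⟩ Q y (ā ▷ z) → _∈⟨_⟩ Q x (ā ▷ z)
  ∈⟨▷⟩-trans {ā = ā} {z = z} (s , s≡x) (u , u≡y) =
    s [ u ]₀ , trans (eval-[]₀ (ā ▷ z) u s) (trans (cong (λ y → eval Q (ā ▷ y) s) u≡y) s≡x)

  module _ {n : ℕ} (ā : Fin n → Carrier) where

    infix 8 _⦅_⦆
    _⦅_⦆ : Term (Fin (suc n)) → Carrier → Carrier
    t ⦅ y ⦆ = eval Q (ā ▷ y) t

    eval-strengthen : ∀ y t (e : occ₀ t ≡ 0) → eval Q ā (strengthen t e) ≡ t ⦅ y ⦆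
    eval-strengthen y (var (F.suc i)) _ = refl
    eval-strengthen y (t ∙ u)         e =
      cong₂ _·_ (eval-strengthen y t _) (eval-strengthen y u _)

    ⦅⦆-occ₀≡0 : ∀ t → occ₀ t ≡ 0 → ∀ y z → t ⦅ y ⦆ ≡ t ⦅ z ⦆
    ⦅⦆-occ₀≡0 t e y z = trans (sym (eval-strengthen y t e)) (eval-strengthen z t e)

    ·-cancel-occ₀≡0 : ∀ t → occ₀ t ≡ 0 → ∀ y z w → t ⦅ z ⦆ · (t ⦅ y ⦆ · w) ≡ w
    ·-cancel-occ₀≡0 t e y z w =
      trans (cong (_· (t ⦅ y ⦆ · w)) (⦅⦆-occ₀≡0 t e z y)) (cancel _ _)

    invert-left : ∀ {t} (p : Once₀ t) y → invert p ⦅ t ⦅ y ⦆ ⦆ ≡ y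
    invert-left here y = refl
    invert-left (_∙ˡ_ {t} {u} p u₀) y = begin
      invert p [ u ∙ var F.zero ]₀ ⦅ z ⦆  ≡⟨ eval-[]₀ (ā ▷ z) (u ∙ var F.zero) (invert p) ⟩
      invert p ⦅ u ⦅ z ⦆ · z ⦆            ≡⟨ cong (invert p ⦅_⦆) u·z≡t ⟩
      invert p ⦅ t ⦅ y ⦆ ⦆                ≡⟨ invert-left p y ⟩
      y                                   ∎
      where
      open ≡-Reasoning
      z : Carrier
      z = (t ∙ u) ⦅ y ⦆
      u·z≡t : u ⦅ z ⦆ · z ≡ t ⦅ y ⦆
      u·z≡t = trans (cong (u ⦅ z ⦆ ·_) (comm _ _)) (·-cancel-occ₀≡0 u u₀ y z (t ⦅ y ⦆))
    invert-left (_∙ʳ_ {t} {u} t₀ p) y = begin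
      invert p [ t ∙ var F.zero ]₀ ⦅ z ⦆  ≡⟨ eval-[]₀ (ā ▷ z) (t ∙ var F.zero) (invert p) ⟩
      invert p ⦅ t ⦅ z ⦆ · z ⦆            ≡⟨ cong (invert p ⦅_⦆) t·z≡u ⟩
      invert p ⦅ u ⦅ y ⦆ ⦆                ≡⟨ invert-left p y ⟩
      y                                   ∎
      where
      open ≡-Reasoning
      z : Carrier
      z = (t ∙ u) ⦅ y ⦆
      t·z≡u : t ⦅ z ⦆ · z ≡ u ⦅ y ⦆
      t·z≡u = ·-cancel-occ₀≡0 t t₀ y z (u ⦅ y ⦆)

    invert-right : ∀ {t} (p : Once₀ t) z → t ⦅ invert p ⦅ z ⦆ ⦆ ≡ z
    invert-right here z = refl
    invert-right (_∙ˡ_ {t} {u} p u₀) z = begin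
      t ⦅ w ⦆ · u ⦅ w ⦆                        ≡⟨ cong (λ v → t ⦅ v ⦆ · u ⦅ w ⦆) w≡ ⟩
      t ⦅ invert p ⦅ u ⦅ z ⦆ · z ⦆ ⦆ · u ⦅ w ⦆  ≡⟨ cong (_· u ⦅ w ⦆) (invert-right p (u ⦅ z ⦆ · z)) ⟩
      (u ⦅ z ⦆ · z) · u ⦅ w ⦆                  ≡⟨ comm _ _ ⟩
      u ⦅ w ⦆ · (u ⦅ z ⦆ · z)                  ≡⟨ ·-cancel-occ₀≡0 u u₀ z w z ⟩
      z                                        ∎
      where
      open ≡-Reasoning
      w : Carrier
      w = invert p [ u ∙ var F.zero ]₀ ⦅ z ⦆
      w≡ : w ≡ invert p ⦅ u ⦅ z ⦆ · z ⦆
      w≡ = eval-[]₀ (ā ▷ z) (u ∙ var F.zero) (invert p)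
    invert-right (_∙ʳ_ {t} {u} t₀ p) z = begin
      t ⦅ w ⦆ · u ⦅ w ⦆                        ≡⟨ cong (λ v → t ⦅ w ⦆ · u ⦅ v ⦆) w≡ ⟩
      t ⦅ w ⦆ · u ⦅ invert p ⦅ t ⦅ z ⦆ · z ⦆ ⦆  ≡⟨ cong (t ⦅ w ⦆ ·_) (invert-right p (t ⦅ z ⦆ · z)) ⟩
      t ⦅ w ⦆ · (t ⦅ z ⦆ · z)                  ≡⟨ ·-cancel-occ₀≡0 t t₀ z w z ⟩
      z                                        ∎
      where
      open ≡-Reasoning
      w : Carrier
      w = invert p [ t ∙ var F.zero ]₀ ⦅ z ⦆
      w≡ : w ≡ invert p ⦅ t ⦅ z ⦆ · z ⦆
      w≡ = eval-[]₀ (ā ▷ z) (t ∙ var F.zero) (invert p)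

  evalₛ : ∀ {m} (g : Fin m → Carrier) → Term (Fin m) → Sub Q g
  evalₛ g t = eval Q g t , t , refl

  hom-eval : ∀ {m} {g : Fin m → Carrier} (B : SteinerQuasigroup)
             {h : Sub Q g → SteinerQuasigroup.Carrier B} {φ} →
             IsHomTo Q B h → (∀ i → h (gen Q g i) ≡ φ i) →
             ∀ x → h x ≡ eval B φ (proj₁ (proj₂ x))
  hom-eval {g = g} B {h} {φ} (resp , hom) h-gen (x , t , t≡x) =
    trans (resp _ (evalₛ g t) (sym t≡x)) (on-terms t)
    where
    on-terms : ∀ t → h (evalₛ g t) ≡ eval B φ t
    on-terms (var i) = h-gen i
    on-terms (t ∙ u) = trans (hom (evalₛ g t) (evalₛ g u))
                             (cong₂ (SteinerQuasigroup._·_ B) (on-terms t) (on-terms u))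

hom-∈⟨▷⟩ : ∀ (Q B : SteinerQuasigroup) {n} {ā : Fin n → SteinerQuasigroup.Carrier Q} {b c}
           {h : Sub Q (ā ▷ b) → SteinerQuasigroup.Carrier B} {φ} →
           IsHomTo Q B h → (∀ i → h (gen Q (ā ▷ b) i) ≡ φ i) →
           _∈⟨_⟩ Q b (ā ▷ c) → ∀ t → eval Q (ā ▷ b) t ≡ c →
           _∈⟨_⟩ B (φ F.zero) ((φ ∘ F.suc) ▷ eval B φ t)
hom-∈⟨▷⟩ Q B {ā = ā} {b} {h = h} {φ} hom h-gen (s , s≡b) t t≡c = s , (begin
  eval B ((φ ∘ F.suc) ▷ eval B φ t) s  ≡⟨ eval-[]₀ B φ t s ⟨
  eval B φ (s [ t ]₀)                  ≡⟨ hom-eval Q B hom h-gen (evalₛ Q (ā ▷ b) (s [ t ]₀)) ⟨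
  h (evalₛ Q (ā ▷ b) (s [ t ]₀))       ≡⟨ proj₁ hom _ _ s[t]≡b ⟩
  h (gen Q (ā ▷ b) F.zero)             ≡⟨ h-gen F.zero ⟩
  φ F.zero                             ∎)
  where
  open ≡-Reasoning
  s[t]≡b : eval Q (ā ▷ b) (s [ t ]₀) ≡ b
  s[t]≡b = proj₂ (∈⟨▷⟩-trans Q (s , s≡b) (t , t≡c))

module FreeSteinerQuasigroup {V : Set} {_<_ : Rel V 0ℓ} (compare : Trichotomous _≡_ _<_) where

  infix 4 _≺_
  data _≺_ : Term V → Term V → Set where
    var<var : ∀ {i j} → i < j → var i ≺ var j
    var<∙   : ∀ {i t u} → var i ≺ t ∙ u
    ∙<∙ˡ    : ∀ {t t′ u u′} → t ≺ t′ → t ∙ u ≺ t′ ∙ u′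
    ∙<∙ʳ    : ∀ {t u u′} → u ≺ u′ → t ∙ u ≺ t ∙ u′

  compareᵗ : Trichotomous _≡_ _≺_
  compareᵗ (var i) (var j) with compare i j
  ... | tri< i<j i≢j j≮i =
    tri< (var<var i<j) (i≢j ∘ var-injective) λ { (var<var j<i) → j≮i j<i }
  ... | tri≈ i≮i refl _ = tri≈ irrefl refl irrefl
    where
    irrefl : ¬ var i ≺ var i
    irrefl (var<var i<i) = i≮i i<i
  ... | tri> i≮j i≢j j<i =
    tri> (λ { (var<var i<j) → i≮j i<j }) (i≢j ∘ var-injective) (var<var j<i)
  compareᵗ (var i) (t ∙ u) = tri< var<∙ (λ ()) (λ ())
  compareᵗ (t ∙ u) (var i) = tri> (λ ()) (λ ()) var<∙
  compareᵗ (t ∙ u) (t′ ∙ u′) with compareᵗ t t′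
  ... | tri< t<t′ t≢t′ t′≮t =
    tri< (∙<∙ˡ t<t′)
         (t≢t′ ∘ proj₁ ∘ ∙-injective)
         (λ { (∙<∙ˡ t′<t) → t′≮t t′<t ; (∙<∙ʳ _) → t≢t′ refl })
  ... | tri> t≮t′ t≢t′ t′<t =
    tri> (λ { (∙<∙ˡ t<t′) → t≮t′ t<t′ ; (∙<∙ʳ _) → t≢t′ refl })
         (t≢t′ ∘ proj₁ ∘ ∙-injective)
         (∙<∙ˡ t′<t)
  ... | tri≈ t≮t refl _ with compareᵗ u u′
  ...   | tri< u<u′ u≢u′ u′≮u =
    tri< (∙<∙ʳ u<u′)
         (u≢u′ ∘ proj₂ ∘ ∙-injective)
         (λ { (∙<∙ˡ t<t) → t≮t t<t ; (∙<∙ʳ u′<u) → u′≮u u′<u })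
  ...   | tri≈ u≮u refl _ = tri≈ irrefl refl irrefl
    where
    irrefl : ¬ t ∙ u ≺ t ∙ u
    irrefl (∙<∙ˡ t<t) = t≮t t<t
    irrefl (∙<∙ʳ u<u) = u≮u u<u
  ...   | tri> u≮u′ u≢u′ u′<u =
    tri> (λ { (∙<∙ˡ t<t) → t≮t t<t ; (∙<∙ʳ u<u′) → u≮u′ u<u′ })
         (u≢u′ ∘ proj₂ ∘ ∙-injective)
         (∙<∙ʳ u′<u)

  _≟ᵗ_ : DecidableEquality (Term V)
  _≟ᵗ_ = tri⇒dec≈ compareᵗ

  ≺-irrefl : ∀ {t u} → t ≡ u → ¬ t ≺ u
  ≺-irrefl = tri⇒irr compareᵗ

  ≺-asym : ∀ {t u} → t ≺ u → ¬ u ≺ t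
  ≺-asym = tri⇒asym compareᵗ

  ord : Term V → Term V → Term V
  ord t u with compareᵗ t u
  ... | tri> _ _ _ = u ∙ t
  ... | _          = t ∙ u

  ord-product : ∀ t u → IsProduct t u (ord t u)
  ord-product t u with compareᵗ t u
  ... | tri< _ _ _ = ordered
  ... | tri≈ _ _ _ = ordered
  ... | tri> _ _ _ = swapped

  ord-≼ : ∀ {t u} → ¬ u ≺ t → ord t u ≡ t ∙ u
  ord-≼ {t} {u} u⊀t with compareᵗ t u
  ... | tri< _ _ _   = refl
  ... | tri≈ _ _ _   = refl
  ... | tri> _ _ u≺t = ⊥-elim (u⊀t u≺t)

  ord-≻ : ∀ {t u} → u ≺ t → ord t u ≡ u ∙ t
  ord-≻ {t} {u} u≺t with compareᵗ t u
  ... | tri< t≺u _ _ = ⊥-elim (≺-asym t≺u u≺t)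
  ... | tri≈ _ t≡u _ = ⊥-elim (≺-irrefl (sym t≡u) u≺t)
  ... | tri> _ _ _   = refl

  ord-comm : ∀ t u → ord t u ≡ ord u t
  ord-comm t u with compareᵗ t u
  ... | tri< t≺u _ _    = sym (ord-≻ t≺u)
  ... | tri≈ _ refl t⊀t = sym (ord-≼ t⊀t)
  ... | tri> _ _ u≺t    = sym (ord-≼ (≺-asym u≺t))

  ord-injective : ∀ {a b c d} → ord a b ≡ ord c d → (a ≡ c × b ≡ d) ⊎ (a ≡ d × b ≡ c)
  ord-injective {a} {b} {c} {d} e =
    IsProduct-injective (ord-product a b) (subst (IsProduct c d) (sym e) (ord-product c d))

  _∣ᵗ?_ : ∀ t p → Dec (t ∣ᵗ p)
  t ∣ᵗ? var _ = no λ { (_ , ()) }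
  t ∣ᵗ? (p ∙ q) with t ≟ᵗ p | t ≟ᵗ q
  ... | yes refl | _        = yes (q , ordered)
  ... | no _     | yes refl = yes (p , swapped)
  ... | no t≢p   | no t≢q   =
    no λ { (_ , ordered) → t≢p refl ; (_ , swapped) → t≢q refl }

  Normal : Term V → Set
  Normal (var _) = ⊤
  Normal (t ∙ u) = Normal t × Normal u × t ≺ u × ¬ t ∣ᵗ u × ¬ u ∣ᵗ t

  normal? : ∀ t → Dec (Normal t)
  normal? (var _) = yes tt
  normal? (t ∙ u) = normal? t ×-dec normal? u ×-dec tri⇒dec< compareᵗ t u
                      ×-dec ¬? (t ∣ᵗ? u) ×-dec ¬? (u ∣ᵗ? t)

  IsProduct-normal : ∀ {t u p} → IsProduct t u p → Normal p → Normal t × Normal u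
  IsProduct-normal ordered (nt , nu , _) = nt , nu
  IsProduct-normal swapped (nu , nt , _) = nt , nu

  ord-normal : ∀ {t u} → Normal t → Normal u → t ≢ u → ¬ t ∣ᵗ u → ¬ u ∣ᵗ t →
               Normal (ord t u)
  ord-normal {t} {u} nt nu t≢u t∤u u∤t with compareᵗ t u
  ... | tri< t≺u _ _ = nt , nu , t≺u , t∤u , u∤t
  ... | tri≈ _ t≡u _ = ⊥-elim (t≢u t≡u)
  ... | tri> _ _ u≺t = nu , nt , u≺t , u∤t , t∤u

  data MulSpec (t u : Term V) : Term V → Set where
    same    : t ≡ u → MulSpec t u t
    cancelˡ : ∀ {w} → IsProduct t w u → MulSpec t u w
    cancelʳ : ∀ {w} → IsProduct u w t → MulSpec t u w
    free    : t ≢ u → ¬ t ∣ᵗ u → ¬ u ∣ᵗ t → MulSpec t u (ord t u)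

  multiply : ∀ t u → ∃ (MulSpec t u)
  multiply t u with t ≟ᵗ u | t ∣ᵗ? u | u ∣ᵗ? t
  ... | yes t≡u | _           | _           = t , same t≡u
  ... | no _    | yes (w , p) | _           = w , cancelˡ p
  ... | no _    | no _        | yes (w , p) = w , cancelʳ p
  ... | no t≢u  | no t∤u      | no u∤t      = ord t u , free t≢u t∤u u∤t

  infixl 7 _⊙_
  _⊙_ : Term V → Term V → Term V
  t ⊙ u = proj₁ (multiply t u)

  ⊙-spec : ∀ t u → MulSpec t u (t ⊙ u)
  ⊙-spec t u = proj₂ (multiply t u)

  MulSpec-functional : ∀ {t u r r′} → MulSpec t u r → MulSpec t u r′ → r ≡ r′
  MulSpec-functional (same _)         (same _)         = refl
  MulSpec-functional (same refl)      (cancelˡ p)      = ⊥-elim (∣ᵗ-irrefl (_ , p))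
  MulSpec-functional (same refl)      (cancelʳ p)      = ⊥-elim (∣ᵗ-irrefl (_ , p))
  MulSpec-functional (same t≡u)       (free t≢u _ _)   = ⊥-elim (t≢u t≡u)
  MulSpec-functional (cancelˡ p)      (same refl)      = ⊥-elim (∣ᵗ-irrefl (_ , p))
  MulSpec-functional (cancelˡ p)      (cancelˡ q)      = IsProduct-functional p q
  MulSpec-functional (cancelˡ p)      (cancelʳ q)      = ⊥-elim (∣ᵗ-asym (_ , p) (_ , q))
  MulSpec-functional (cancelˡ p)      (free _ t∤u _)   = ⊥-elim (t∤u (_ , p))
  MulSpec-functional (cancelʳ p)      (same refl)      = ⊥-elim (∣ᵗ-irrefl (_ , p))
  MulSpec-functional (cancelʳ p)      (cancelˡ q)      = ⊥-elim (∣ᵗ-asym (_ , p) (_ , q))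
  MulSpec-functional (cancelʳ p)      (cancelʳ q)      = IsProduct-functional p q
  MulSpec-functional (cancelʳ p)      (free _ _ u∤t)   = ⊥-elim (u∤t (_ , p))
  MulSpec-functional (free t≢u _ _)   (same t≡u)       = ⊥-elim (t≢u t≡u)
  MulSpec-functional (free _ t∤u _)   (cancelˡ p)      = ⊥-elim (t∤u (_ , p))
  MulSpec-functional (free _ _ u∤t)   (cancelʳ p)      = ⊥-elim (u∤t (_ , p))
  MulSpec-functional (free _ _ _)     (free _ _ _)     = refl

  ⊙-unique : ∀ {t u r} → MulSpec t u r → t ⊙ u ≡ r
  ⊙-unique = MulSpec-functional (⊙-spec _ _)

  MulSpec-comm : ∀ {t u r} → MulSpec t u r → MulSpec u t r
  MulSpec-comm (same refl)                = same refl
  MulSpec-comm (cancelˡ p)                = cancelʳ p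
  MulSpec-comm (cancelʳ p)                = cancelˡ p
  MulSpec-comm {t} {u} (free t≢u t∤u u∤t) =
    subst (MulSpec u t) (ord-comm u t) (free (≢-sym t≢u) u∤t t∤u)

  normal-product-spec : ∀ {t u p} → IsProduct t u p → Normal p → MulSpec t u p
  normal-product-spec ordered (_ , _ , t≺u , t∤u , u∤t) =
    subst (MulSpec _ _) (ord-≼ (≺-asym t≺u)) (free (λ t≡u → ≺-irrefl t≡u t≺u) t∤u u∤t)
  normal-product-spec swapped n = MulSpec-comm (normal-product-spec ordered n)

  MulSpec-cancel : ∀ {t u r} → Normal u → MulSpec t u r → MulSpec t r u
  MulSpec-cancel _  (same refl)  = same refl
  MulSpec-cancel nu (cancelˡ p)  = normal-product-spec p nu
  MulSpec-cancel _  (cancelʳ p)  = cancelʳ (IsProduct-comm p)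
  MulSpec-cancel _  (free _ _ _) = cancelˡ (ord-product _ _)

  MulSpec-normal : ∀ {t u r} → Normal t → Normal u → MulSpec t u r → Normal r
  MulSpec-normal nt _  (same refl)          = nt
  MulSpec-normal _  nu (cancelˡ p)          = proj₂ (IsProduct-normal p nu)
  MulSpec-normal nt _  (cancelʳ p)          = proj₂ (IsProduct-normal p nt)
  MulSpec-normal nt nu (free t≢u t∤u u∤t)   = ord-normal nt nu t≢u t∤u u∤t

  ⊙-comm : ∀ t u → t ⊙ u ≡ u ⊙ t
  ⊙-comm t u = ⊙-unique (MulSpec-comm (⊙-spec u t))

  ⊙-idem : ∀ t → t ⊙ t ≡ t
  ⊙-idem t = ⊙-unique (same refl)

  ⊙-cancel : ∀ t {u} → Normal u → t ⊙ (t ⊙ u) ≡ u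
  ⊙-cancel t {u} nu = ⊙-unique (MulSpec-cancel nu (⊙-spec t u))

  ⊙-normal : ∀ {t u} → Normal t → Normal u → Normal (t ⊙ u)
  ⊙-normal {t} {u} nt nu = MulSpec-normal nt nu (⊙-spec t u)

  ⊙-normal-product : ∀ {t u p} → IsProduct t u p → Normal p → t ⊙ u ≡ p
  ⊙-normal-product p np = ⊙-unique (normal-product-spec p np)

  record NormalForm : Set where
    constructor nf
    field
      term    : Term V
      .normal : Normal term
  open NormalForm public

  isNormal : (E : NormalForm) → Normal (term E)
  isNormal (nf t nt) = recompute (normal? t) nt

  NormalForm-≡ : ∀ {E F : NormalForm} → term E ≡ term F → E ≡ F
  NormalForm-≡ refl = refl

  infixl 7 _⊙ᴺ_
  _⊙ᴺ_ : NormalForm → NormalForm → NormalForm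
  nf t nt ⊙ᴺ nf u nu = nf (t ⊙ u) (⊙-normal nt nu)

  Free : SteinerQuasigroup
  Free = record
    { Carrier = NormalForm
    ; _·_     = _⊙ᴺ_
    ; comm    = λ E F → NormalForm-≡ (⊙-comm (term E) (term F))
    ; idem    = λ E → NormalForm-≡ (⊙-idem (term E))
    ; cancel  = λ E F → NormalForm-≡ (⊙-cancel (term E) (isNormal F))
    }

  ⟪_⟫ : V → NormalForm
  ⟪ v ⟫ = nf (var v) tt

  module _ (Q : SteinerQuasigroup) where
    open SteinerQuasigroup Q

    IsProduct-eval : ∀ (ρ : V → Carrier) {t u p} → IsProduct t u p →
                     eval Q ρ p ≡ eval Q ρ t · eval Q ρ u
    IsProduct-eval ρ ordered = refl
    IsProduct-eval ρ swapped = comm _ _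

    IsProduct-cofactor : ∀ (ρ : V → Carrier) {t u p} → IsProduct t u p →
                         eval Q ρ t · eval Q ρ p ≡ eval Q ρ u
    IsProduct-cofactor ρ {t} p = trans (cong (eval Q ρ t ·_) (IsProduct-eval ρ p)) (cancel _ _)

    MulSpec-eval : ∀ (ρ : V → Carrier) {t u r} → MulSpec t u r →
                   eval Q ρ r ≡ eval Q ρ t · eval Q ρ u
    MulSpec-eval ρ (same refl)           = sym (idem _)
    MulSpec-eval ρ (cancelˡ p)           = sym (IsProduct-cofactor ρ p)
    MulSpec-eval ρ (cancelʳ p)           = sym (trans (comm _ _) (IsProduct-cofactor ρ p))
    MulSpec-eval ρ {t} {u} (free _ _ _)  = IsProduct-eval ρ (ord-product t u)

    eval-normalise : ∀ (ρ : V → Carrier) t → eval Q ρ (term (eval Free ⟪_⟫ t)) ≡ eval Q ρ t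
    eval-normalise ρ (var v) = refl
    eval-normalise ρ (t ∙ u) =
      trans (MulSpec-eval ρ (⊙-spec (term (eval Free ⟪_⟫ t)) (term (eval Free ⟪_⟫ u))))
            (cong₂ _·_ (eval-normalise ρ t) (eval-normalise ρ u))

  canon : Term V → Term V
  canon (var v) = var v
  canon (t ∙ u) = ord (canon t) (canon u)

  canon-step : ∀ {s t} → CommStep s t → canon s ≡ canon t
  canon-step (here t u)   = ord-comm (canon t) (canon u)
  canon-step (left u st)  = cong (λ c → ord c (canon u)) (canon-step st)
  canon-step (right t st) = cong (ord (canon t)) (canon-step st)

  canon-∼ : ∀ {s t} → s ∼ t → canon s ≡ canon t
  canon-∼ ε          = refl
  canon-∼ (st ◅ s∼t) = trans (canon-step st) (canon-∼ s∼t)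

  canon-normal : ∀ {t} → Normal t → canon t ≡ t
  canon-normal {var v} _                 = refl
  canon-normal {t ∙ u} (nt , nu , t≺u , _) =
    trans (cong₂ ord (canon-normal nt) (canon-normal nu)) (ord-≼ (≺-asym t≺u))

  ∼-normal : ∀ {s t} → Normal s → Normal t → s ∼ t → s ≡ t
  ∼-normal ns nt s∼t = trans (sym (canon-normal ns)) (trans (canon-∼ s∼t) (canon-normal nt))

  normal-⊑ : ∀ {s t} → s ⊑ t → Normal t → Normal s
  normal-⊑ self       n            = n
  normal-⊑ (inl s⊑t) (nt , _)      = normal-⊑ s⊑t nt
  normal-⊑ (inr s⊑u) (_ , nu , _)  = normal-⊑ s⊑u nu

  forbidden-¬normal : ∀ {s} → Forbidden s → ¬ Normal s
  forbidden-¬normal (f-idem t₁∼t₂) (n₁ , n₂ , t₁≺t₂ , _) = ≺-irrefl (∼-normal n₁ n₂ t₁∼t₂) t₁≺t₂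
  forbidden-¬normal (f-r₁ t₁∼t₂) (n₁ , (n₂ , _) , _ , t₁∤ , _) with ∼-normal n₁ n₂ t₁∼t₂
  ... | refl = t₁∤ (_ , ordered)
  forbidden-¬normal (f-r₂ t₁∼t₃) (n₁ , (_ , n₃ , _) , _ , t₁∤ , _) with ∼-normal n₁ n₃ t₁∼t₃
  ... | refl = t₁∤ (_ , swapped)
  forbidden-¬normal (f-l₁ t₁∼t₃) ((n₁ , _) , n₃ , _ , _ , t₃∤) with ∼-normal n₁ n₃ t₁∼t₃
  ... | refl = t₃∤ (_ , ordered)
  forbidden-¬normal (f-l₂ t₂∼t₃) ((_ , n₂ , _) , n₃ , _ , _ , t₃∤) with ∼-normal n₂ n₃ t₂∼t₃
  ... | refl = t₃∤ (_ , swapped)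

  normal⇒reduced : ∀ {t} → Normal t → Reduced t
  normal⇒reduced nt s s⊑t forbidden = forbidden-¬normal forbidden (normal-⊑ s⊑t nt)

open module FreeOnFin {m : ℕ} = FreeSteinerQuasigroup (Fin.<-cmp {m})

module _ {n : ℕ} where

  x̄ : Fin n → NormalForm
  x̄ = ⟪_⟫ ∘ F.suc

  occ₀-cofactor : ∀ {u w p : Term (Fin (suc n))} → IsProduct u w p → occ₀ u ≡ 0 →
                  occ₀ p ≡ occ₀ w
  occ₀-cofactor {w = w} p u₀ = trans (occ₀-IsProduct p) (cong (_+ occ₀ w) u₀)

  x̄-fixes : ∀ (E : NormalForm) {t} → Normal t → occ₀ t ≡ 0 → term (eval Free (x̄ ▷ E) t) ≡ t
  x̄-fixes E {var (F.suc i)} _ _ = refl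
  x̄-fixes E {t ∙ u} n@(nt , nu , _) e =
    trans (cong₂ _⊙_ (x̄-fixes E nt (m+n≡0⇒m≡0 (occ₀ t) e))
                     (x̄-fixes E nu (m+n≡0⇒n≡0 (occ₀ t) e)))
          (⊙-normal-product ordered n)

  ∈⟨x̄▷cofactor⟩ : ∀ {u w p} (pr : IsProduct u w p) (np : Normal p) → occ₀ u ≡ 0 →
                  _∈⟨_⟩ Free (nf p np) (x̄ ▷ nf w (proj₂ (IsProduct-normal pr np)))
  ∈⟨x̄▷cofactor⟩ {u} {w} {p} pr np u₀ = u ∙ var F.zero , NormalForm-≡ (begin
    term (eval Free (x̄ ▷ W) u) ⊙ w  ≡⟨ cong (_⊙ w) (x̄-fixes W (proj₁ (IsProduct-normal pr np)) u₀) ⟩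
    u ⊙ w                           ≡⟨ ⊙-normal-product pr np ⟩
    p                               ∎)
    where
    open ≡-Reasoning
    W : NormalForm
    W = nf w (proj₂ (IsProduct-normal pr np))

  -- Since both factors of T contain x₀, counting occurrences of x₀ shows that no θ t is a
  -- factor of T; hence θ commutes with ⊙ on normal forms.
  module Substitution (T₁ T₂ : Term (Fin (suc n))) (T-normal : Normal (T₁ ∙ T₂))
                      (T₁-occ : 0 < occ₀ T₁) (T₂-occ : 0 < occ₀ T₂) where

    T : Term (Fin (suc n))
    T = T₁ ∙ T₂

    θ : Term (Fin (suc n)) → Term (Fin (suc n))
    θ (var F.zero)    = T
    θ (var (F.suc i)) = var (F.suc i)
    θ (t ∙ u)         = ord (θ t) (θ u)

    occ₀-θ : ∀ t → occ₀ (θ t) ≡ occ₀ t * occ₀ T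
    occ₀-θ (var F.zero)    = sym (*-identityˡ (occ₀ T))
    occ₀-θ (var (F.suc i)) = refl
    occ₀-θ (t ∙ u) = begin
      occ₀ (ord (θ t) (θ u))                ≡⟨ occ₀-IsProduct (ord-product (θ t) (θ u)) ⟩
      occ₀ (θ t) + occ₀ (θ u)               ≡⟨ cong₂ _+_ (occ₀-θ t) (occ₀-θ u) ⟩
      occ₀ t * occ₀ T + occ₀ u * occ₀ T     ≡⟨ *-distribʳ-+ (occ₀ T) (occ₀ t) (occ₀ u) ⟨
      (occ₀ t + occ₀ u) * occ₀ T            ∎
      where open ≡-Reasoning

    occ₀T∣occ₀-θ : ∀ t → occ₀ T ∣ occ₀ (θ t)
    occ₀T∣occ₀-θ t = divides (occ₀ t) (occ₀-θ t)

    θ∤T : ∀ t → ¬ θ t ∣ᵗ T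
    θ∤T t θt∣T with ∣ᵗ-IsProduct θt∣T ordered
    ... | inj₁ θt≡T₁ = >⇒∤ {{>-nonZero T₁-occ}} (m<m+n (occ₀ T₁) T₂-occ)
                          (subst (occ₀ T ∣_) (cong occ₀ θt≡T₁) (occ₀T∣occ₀-θ t))
    ... | inj₂ θt≡T₂ = >⇒∤ {{>-nonZero T₂-occ}} (m<n+m (occ₀ T₂) T₁-occ)
                          (subst (occ₀ T ∣_) (cong occ₀ θt≡T₂) (occ₀T∣occ₀-θ t))

    θ-IsProduct : ∀ {t u p} → IsProduct t u p → IsProduct (θ t) (θ u) (θ p)
    θ-IsProduct {t} {u} ordered = ord-product (θ t) (θ u)
    θ-IsProduct {t} {u} swapped = IsProduct-comm (ord-product (θ u) (θ t))

    θ-ord : ∀ t u → θ (ord t u) ≡ ord (θ t) (θ u)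
    θ-ord t u with ord t u | ord-product t u
    ... | .(t ∙ u) | ordered = refl
    ... | .(u ∙ t) | swapped = ord-comm (θ u) (θ t)

    θ-product≢T : ∀ t u → θ (t ∙ u) ≢ T
    θ-product≢T t u e = θ∤T t (θ u , subst (IsProduct (θ t) (θ u)) e (ord-product (θ t) (θ u)))

    θ-product≢var : ∀ t u i → θ (t ∙ u) ≢ var i
    θ-product≢var t u i e with subst (IsProduct (θ t) (θ u)) e (ord-product (θ t) (θ u))
    ... | ()

    θ-injective : ∀ {t u} → Normal t → Normal u → θ t ≡ θ u → t ≡ u
    θ-injective {var F.zero}    {var F.zero}    _ _ _ = refl
    θ-injective {var (F.suc i)} {var (F.suc j)} _ _ e = e
    θ-injective {var F.zero}    {c ∙ d}         _ _ e = ⊥-elim (θ-product≢T c d (sym e))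
    θ-injective {c ∙ d}         {var F.zero}    _ _ e = ⊥-elim (θ-product≢T c d e)
    θ-injective {var (F.suc i)} {c ∙ d}         _ _ e = ⊥-elim (θ-product≢var c d _ (sym e))
    θ-injective {c ∙ d}         {var (F.suc i)} _ _ e = ⊥-elim (θ-product≢var c d _ e)
    θ-injective {a ∙ b} {c ∙ d} (na , nb , a≺b , _) (nc , nd , c≺d , _) e with ord-injective e
    ... | inj₁ (θa≡θc , θb≡θd) = cong₂ _∙_ (θ-injective na nc θa≡θc) (θ-injective nb nd θb≡θd)
    ... | inj₂ (θa≡θd , θb≡θc) with θ-injective na nd θa≡θd | θ-injective nb nc θb≡θc
    ...   | refl | refl = ⊥-elim (≺-asym a≺b c≺d)

    θ-∣ᵗ : ∀ {t u} → Normal t → Normal u → θ t ∣ᵗ θ u → t ∣ᵗ u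
    θ-∣ᵗ {t} {var F.zero}    _ _ θt∣T   = ⊥-elim (θ∤T t θt∣T)
    θ-∣ᵗ {t} {var (F.suc i)} _ _ (_ , ())
    θ-∣ᵗ {t} {p ∙ q} nt (np , nq , _) θt∣θu with ∣ᵗ-IsProduct θt∣θu (ord-product (θ p) (θ q))
    ... | inj₁ θt≡θp = subst (_∣ᵗ p ∙ q) (sym (θ-injective nt np θt≡θp)) (q , ordered)
    ... | inj₂ θt≡θq = subst (_∣ᵗ p ∙ q) (sym (θ-injective nt nq θt≡θq)) (p , swapped)

    MulSpec-θ : ∀ {t u r} → Normal t → Normal u → MulSpec t u r → MulSpec (θ t) (θ u) (θ r)
    MulSpec-θ _ _ (same refl) = same refl
    MulSpec-θ _ _ (cancelˡ p) = cancelˡ (θ-IsProduct p)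
    MulSpec-θ _ _ (cancelʳ p) = cancelʳ (θ-IsProduct p)
    MulSpec-θ {t} {u} nt nu (free t≢u t∤u u∤t) =
      subst (MulSpec (θ t) (θ u)) (sym (θ-ord t u))
        (free (t≢u ∘ θ-injective nt nu) (t∤u ∘ θ-∣ᵗ nt nu) (u∤t ∘ θ-∣ᵗ nu nt))

    θ-⊙ : ∀ {t u} → Normal t → Normal u → θ t ⊙ θ u ≡ θ (t ⊙ u)
    θ-⊙ {t} {u} nt nu = ⊙-unique (MulSpec-θ nt nu (⊙-spec t u))

    eval-θ : ∀ s → term (eval Free (x̄ ▷ nf T T-normal) s) ≡ θ (term (eval Free ⟪_⟫ s))
    eval-θ (var F.zero)    = refl
    eval-θ (var (F.suc i)) = refl
    eval-θ (s ∙ s′) = trans (cong₂ _⊙_ (eval-θ s) (eval-θ s′))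
                            (θ-⊙ (isNormal (eval Free ⟪_⟫ s)) (isNormal (eval Free ⟪_⟫ s′)))

    x₀∉⟨x̄▷T⟩ : ¬ _∈⟨_⟩ Free ⟪ F.zero ⟫ (x̄ ▷ nf T T-normal)
    x₀∉⟨x̄▷T⟩ (s , e) =
      >⇒∤ (+-mono-≤ T₁-occ T₂-occ) (subst (occ₀ T ∣_) (cong occ₀ θS≡x₀) (occ₀T∣occ₀-θ S))
      where
      S : Term (Fin (suc n))
      S = term (eval Free ⟪_⟫ s)
      θS≡x₀ : θ S ≡ var F.zero
      θS≡x₀ = trans (sym (eval-θ s)) (cong term e)

  x₀∉⟨x̄▷_⟩ : ∀ T (nT : Normal T) → 2 ≤ occ₀ T → ¬ _∈⟨_⟩ Free ⟪ F.zero ⟫ (x̄ ▷ nf T nT)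
  x₀∉⟨x̄▷ var F.zero ⟩ _ (s≤s ())
  x₀∉⟨x̄▷ T₁ ∙ T₂ ⟩ nT@(n₁ , n₂ , _) 2≤occ x₀∈ with occ₀ T₁ ≟ 0 | occ₀ T₂ ≟ 0
  ... | yes o₁ | _ =
    x₀∉⟨x̄▷ T₂ ⟩ n₂ (subst (2 ≤_) (occ₀-cofactor {T₁} {T₂} ordered o₁) 2≤occ)
                   (∈⟨▷⟩-trans Free x₀∈ (∈⟨x̄▷cofactor⟩ ordered nT o₁))
  ... | no _ | yes o₂ =
    x₀∉⟨x̄▷ T₁ ⟩ n₁ (subst (2 ≤_) (occ₀-cofactor {T₂} {T₁} swapped o₂) 2≤occ)
                   (∈⟨▷⟩-trans Free x₀∈ (∈⟨x̄▷cofactor⟩ swapped nT o₂))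
  ... | no o₁ | no o₂ =
    Substitution.x₀∉⟨x̄▷T⟩ T₁ T₂ nT (n≢0⇒n>0 o₁) (n≢0⇒n>0 o₂) x₀∈

module _ (Q : SteinerQuasigroup) {n : ℕ} (ā : Fin n → SteinerQuasigroup.Carrier Q)
         (b c : SteinerQuasigroup.Carrier Q) where
  open SteinerQuasigroup Q

  IsExtension : (Sub Q (ā ▷ b) → Sub Q (ā ▷ b)) → Set
  IsExtension f = IsEndo Q f ×
                  (∀ i → proj₁ (f (gen Q (ā ▷ b) (F.suc i))) ≡ ā i) ×
                  (proj₁ (f (gen Q (ā ▷ b) F.zero)) ≡ c)

  extension-eval : ∀ {f} → IsExtension f → ∀ x → proj₁ (f x) ≡ eval Q (ā ▷ c) (proj₁ (proj₂ x))
  extension-eval {f} (endo , f-ā , f-b) = hom-eval Q Q endo on-generators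
    where
    on-generators : ∀ i → proj₁ (f (gen Q (ā ▷ b) i)) ≡ (ā ▷ c) i
    on-generators F.zero    = f-b
    on-generators (F.suc i) = f-ā i

  image-⊆ : ∀ {f} → IsExtension f → ∀ x → _∈⟨_⟩ Q (proj₁ (f x)) (ā ▷ c)
  image-⊆ {f} ext x = proj₁ (proj₂ x) , sym (extension-eval {f} ext x)

  image-⊇ : ∀ {f} → IsExtension f → ∀ {y} → _∈⟨_⟩ Q y (ā ▷ c) → ∃ λ x → proj₁ (f x) ≡ y
  image-⊇ {f} ext (t , t≡y) =
    evalₛ Q (ā ▷ b) t , trans (extension-eval {f} ext (evalₛ Q (ā ▷ b) t)) t≡y

  extension-exists : Independent Q (ā ▷ b) → _∈⟨_⟩ Q c (ā ▷ b) → ∃ IsExtension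
  extension-exists (_ , extend) c∈ with extend Q (ā ▷ c)
  ... | h , h-hom , h-gen , _ = f , h-hom , h-gen ∘ F.suc , h-gen F.zero
    where
    f : Sub Q (ā ▷ b) → Sub Q (ā ▷ b)
    f x = h x , ∈⟨▷⟩-trans Q (proj₁ (proj₂ x) , sym (hom-eval Q Q h-hom h-gen x)) c∈

  ∈⇒surjective : _∈⟨_⟩ Q b (ā ▷ c) → ∀ f → IsExtension f → SurjectiveSub Q f
  ∈⇒surjective b∈ f ext (y , y∈) = image-⊇ {f} ext (∈⟨▷⟩-trans Q y∈ b∈)

  surjective⇒∈ : ∃ IsExtension → (∀ f → IsExtension f → SurjectiveSub Q f) → _∈⟨_⟩ Q b (ā ▷ c)
  surjective⇒∈ (f , ext) surjective with surjective f ext (gen Q (ā ▷ b) F.zero)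
  ... | x , fx≡b = subst (λ y → _∈⟨_⟩ Q y (ā ▷ c)) fx≡b (image-⊆ {f} ext x)

  once⇒∈ : ∀ t → occ₀ t ≡ 1 → c ≡ eval Q (ā ▷ b) t → _∈⟨_⟩ Q b (ā ▷ c)
  once⇒∈ t once c≡ =
    invert p , subst (λ z → eval Q (ā ▷ z) (invert p) ≡ b) (sym c≡) (invert-left Q ā p b)
    where
    p : Once₀ t
    p = once₀ t once

  extension-retraction : ∀ {t} → c ≡ eval Q (ā ▷ b) t → ∀ {d} → eval Q (ā ▷ d) t ≡ b →
                         ∀ {k} → IsHomTo Q Q k → (∀ i → k (gen Q (ā ▷ b) i) ≡ (ā ▷ d) i) →
                         ∀ {f} → IsExtension f → ∀ x → k (f x) ≡ proj₁ x
  extension-retraction {t} c≡ {d} t[d]≡b {k} k-hom k-gen {f} ext (x , s , s≡x) = begin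
    k (f (x , s , s≡x))              ≡⟨ proj₁ k-hom _ _ fx≡s[t] ⟩
    k (evalₛ Q (ā ▷ b) (s [ t ]₀))   ≡⟨ hom-eval Q Q k-hom k-gen _ ⟩
    eval Q (ā ▷ d) (s [ t ]₀)        ≡⟨ eval-[]₀ Q (ā ▷ d) t s ⟩
    eval Q (ā ▷ eval Q (ā ▷ d) t) s  ≡⟨ cong (λ z → eval Q (ā ▷ z) s) t[d]≡b ⟩
    eval Q (ā ▷ b) s                 ≡⟨ s≡x ⟩
    x                                ∎
    where
    open ≡-Reasoning
    fx≡s[t] : proj₁ (f (x , s , s≡x)) ≡ eval Q (ā ▷ b) (s [ t ]₀)
    fx≡s[t] = trans (extension-eval {f} ext _)
                    (trans (cong (λ z → eval Q (ā ▷ z) s) c≡) (sym (eval-[]₀ Q (ā ▷ b) t s)))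

  once⇒injective : Independent Q (ā ▷ b) → ∀ t → occ₀ t ≡ 1 → c ≡ eval Q (ā ▷ b) t →
                   ∀ f → IsExtension f → InjectiveSub Q f
  once⇒injective (_ , extend) t once c≡ f ext x y fx≡fy =
    let k , k-hom , k-gen , _ = extend Q (ā ▷ eval Q (ā ▷ b) (invert p))
        k∘f≡id = extension-retraction {t} c≡ (invert-right Q ā p b) k-hom k-gen ext
    in trans (sym (k∘f≡id x)) (trans (proj₁ k-hom (f x) (f y) fx≡fy) (k∘f≡id y))
    where
    p : Once₀ t
    p = once₀ t once

  ∈⇒reduced-once : Independent Q (ā ▷ b) → _∈⟨_⟩ Q c (ā ▷ b) → ¬ _∈⟨_⟩ Q c ā →
                   _∈⟨_⟩ Q b (ā ▷ c) →
                   ∃ λ t → Reduced t × occ₀ t ≡ 1 × c ≡ eval Q (ā ▷ b) t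
  ∈⇒reduced-once (_ , extend) (t₀ , t₀≡c) c∉⟨ā⟩ b∈ = by-occurrences (occ₀ T) refl
    where
    E : NormalForm
    E = eval Free ⟪_⟫ t₀
    T : Term (Fin (suc n))
    T = term E
    c≡T : c ≡ eval Q (ā ▷ b) T
    c≡T = trans (sym t₀≡c) (sym (eval-normalise Q (ā ▷ b) t₀))
    x₀∈⟨x̄▷E⟩ : _∈⟨_⟩ Free ⟪ F.zero ⟫ (x̄ ▷ E)
    x₀∈⟨x̄▷E⟩ = let _ , h-hom , h-gen , _ = extend Free ⟪_⟫
               in hom-∈⟨▷⟩ Q Free h-hom h-gen b∈ t₀ t₀≡c
    by-occurrences : ∀ k → occ₀ T ≡ k → ∃ λ t → Reduced t × occ₀ t ≡ 1 × c ≡ eval Q (ā ▷ b) t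
    by-occurrences 0 e =
      ⊥-elim (c∉⟨ā⟩ (strengthen T e , trans (eval-strengthen Q ā b T e) (sym c≡T)))
    by-occurrences 1 e = T , normal⇒reduced (isNormal E) , e , c≡T
    by-occurrences (suc (suc _)) e =
      ⊥-elim (x₀∉⟨x̄▷ T ⟩ (isNormal E) (subst (2 ≤_) (sym e) (s≤s (s≤s z≤n))) x₀∈⟨x̄▷E⟩)

corollary6p10 : (Q : SteinerQuasigroup) → let open SteinerQuasigroup Q in
    ∀ (n : ℕ) (ā : Fin n → Carrier) (b c : Carrier) →
    Independent Q (ā ▷ b) →
    (cm : _∈⟨_⟩ Q c (ā ▷ b)) → ¬ (_∈⟨_⟩ Q c ā) →
    let
      P₁ = _∈⟨_⟩ Q b (ā ▷ c)
      P₂ = ∃ λ (t : Term (Fin (suc n))) →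
             Reduced t × (occ₀ t ≡ 1) × (c ≡ eval Q (ā ▷ b) t)
      Ext = λ (f : Sub Q (ā ▷ b) → Sub Q (ā ▷ b)) →
              IsEndo Q f ×
              (∀ i → proj₁ (f (gen Q (ā ▷ b) (F.suc i))) ≡ ā i) ×
              (proj₁ (f (gen Q (ā ▷ b) F.zero)) ≡ c)
      P₃ = ∀ f → Ext f → SurjectiveSub Q f
      P₄ = ∀ f → Ext f → IsAutomorphism Q f
    in (P₁ ⇔ P₂) × (P₁ ⇔ P₃) × (P₁ ⇔ P₄)
corollary6p10 Q n ā b c independent c∈ c∉⟨ā⟩ =
    mk⇔ reduced-once (λ (t , _ , once , c≡) → once⇒∈ Q ā b c t once c≡)
  , mk⇔ (∈⇒surjective Q ā b c) (surjective⇒∈ Q ā b c extension)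
  , mk⇔ (λ b∈ f ext → proj₁ ext , injective b∈ f ext , ∈⇒surjective Q ā b c b∈ f ext)
        (λ automorphic → surjective⇒∈ Q ā b c extension
                           (λ f ext → proj₂ (proj₂ (automorphic f ext))))
  where
  extension : ∃ (IsExtension Q ā b c)
  extension = extension-exists Q ā b c independent c∈

  reduced-once : _∈⟨_⟩ Q b (ā ▷ c) → ∃ λ t → Reduced t × occ₀ t ≡ 1 × c ≡ eval Q (ā ▷ b) t
  reduced-once = ∈⇒reduced-once Q ā b c independent c∈ c∉⟨ā⟩

  injective : _∈⟨_⟩ Q b (ā ▷ c) → ∀ f → IsExtension Q ā b c f → InjectiveSub Q f
  injective b∈ = let t , _ , once , c≡ = reduced-once b∈
                 in once⇒injective Q ā b c independent t once c≡
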